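{- Let $\mathcal{F}$ be a family of graphs and let $\mathcal{H}$ be a Berge-$\mathcal{F}$-free $r$-graph. Then one can construct an $\mathcal{F}$-free red-blue graph $G^{rb}$ with vertex set $V(G)=V(\mathcal{H})$ such that: there is a matching $M$ between $E(G)$ and $E(\mathcal{H})$ in the auxiliary bipartite graph of $\mathcal{H}$ that covers $E(G)$; $e(\mathcal{H})\leq g_r(G^{rb})$; and each hyperedge of $\mathcal{H}$ contains either a blue edge or a red copy of $K_r$ of $G$.
   Context: An $r$-graph is a hypergraph all of whose hyperedges are $r$-sets. For a graph $F$, an $r$-graph is a Berge-$F$ if there is a bijection $\phi:E(F)\to E(\mathcal{H})$ with $e\subseteq\phi(e)$ for all $e$; $\mathcal{H}$ is Berge-$\mathcal{F}$-free if it contains no Berge-$F$ subhypergraph for any $F\in\mathcal{F}$, and a graph is $\mathcal{F}$-free if it contains no member of $\mathcal{F}$ as a subgraph. A red-blue graph $G^{rb}$ is a graph $G$ with each edge colored red or blue; $G_{\mathrm{red}}$, $G_{\mathrm{blue}}$ are the subgraphs formed by red, respectively blue, edges, and $g_r(G^{rb}):=e(G_{\mathrm{blue}})+\mathcal{N}(K_r,G_{\mathrm{red}})$, where $\mathcal{N}(K_r,\cdot)$ counts copies of $K_r$. The auxiliary bipartite graph of $\mathcal{H}$ has one part $A$ consisting of all $2$-subsets of $V(\mathcal{H})$, other part $B=E(\mathcal{H})$, and $a\in A$ adjacent to $b\in B$ iff $a\subseteq b$; edges of $G$ are regarded as elements of $A$. -}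

module Defs where

open import Data.Nat using (ℕ; zero; suc; _≤_; _≡ᵇ_)
open import Data.Bool using (Bool; true; false; _∧_; _∨_; not; if_then_else_)
open import Data.Fin using (Fin; _<_; toℕ)
import Data.Nat as N

_<ᵇ_ : ∀ {n} → Fin n → Fin n → Bool
i <ᵇ j = toℕ i N.<ᵇ toℕ j
open import Data.Fin.Subset using (Subset; _∈_; _⊆_; ∣_∣)
open import Data.Vec using (Vec; []; _∷_; lookup)
open import Data.List using (List; []; _∷_; length; map; _++_; allFin; cartesianProduct)
import Data.List as L
open import Data.List.Relation.Unary.All using (All)
open import Data.List.Relation.Unary.Unique.Propositional using (Unique)
open import Data.Product using (Σ; _×_; _,_; proj₁; proj₂; ∃)
open import Data.Sum using (_⊎_)
open import Relation.Nullary using (¬_)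
open import Relation.Binary.PropositionalEquality using (_≡_)

record Graph (k : ℕ) : Set where
  field
    adj    : Fin k → Fin k → Bool
    sym    : ∀ u v → adj u v ≡ adj v u
    irrefl : ∀ u → adj u u ≡ false

open Graph public

Edge : ∀ {k} → Graph k → Set
Edge {k} F = Σ (Fin k × Fin k) λ p → (proj₁ p < proj₂ p) × (adj F (proj₁ p) (proj₂ p) ≡ true)

Family : Set₁
Family = (k : ℕ) → Graph k → Set

SubgraphCopy : ∀ {k n} → Graph k → Graph n → Set
SubgraphCopy {k} {n} F G =
  Σ (Fin k → Fin n) λ f →
    (∀ u v → f u ≡ f v → u ≡ v) ×
    (∀ u v → adj F u v ≡ true → adj G (f u) (f v) ≡ true)

FFree : ∀ {n} → Family → Graph n → Set
FFree 𝓕 G = ∀ k (F : Graph k) → 𝓕 k F → ¬ SubgraphCopy F G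

record RGraph (r n : ℕ) : Set where
  field
    hedges  : List (Subset n)
    unique  : Unique hedges
    uniform : All (λ h → ∣ h ∣ ≡ r) hedges

open RGraph public

eH : ∀ {r n} → RGraph r n → ℕ
eH H = length (hedges H)

hedge : ∀ {r n} (H : RGraph r n) → Fin (eH H) → Subset n
hedge H i = L.lookup (hedges H) i

BergeCopy : ∀ {k r n} → Graph k → RGraph r n → Set
BergeCopy {k} {r} {n} F H =
  Σ (Fin k → Fin n) λ f →
    (∀ u v → f u ≡ f v → u ≡ v) ×
    Σ (Edge F → Fin (eH H)) λ φ →
      (∀ e₁ e₂ → φ e₁ ≡ φ e₂ → proj₁ e₁ ≡ proj₁ e₂) ×
      (∀ e → (f (proj₁ (proj₁ e)) ∈ hedge H (φ e)) × (f (proj₂ (proj₁ e)) ∈ hedge H (φ e)))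

BergeFree : ∀ {r n} → Family → RGraph r n → Set
BergeFree 𝓕 H = ∀ k (F : Graph k) → 𝓕 k F → ¬ BergeCopy F H

data Colour : Set where
  none red blue : Colour

isRed isBlue isEdgeC : Colour → Bool
isRed red = true
isRed _ = false
isBlue blue = true
isBlue _ = false
isEdgeC none = false
isEdgeC _ = true

record RBGraph (n : ℕ) : Set where
  field
    col       : Fin n → Fin n → Colour
    colSym    : ∀ i j → col i j ≡ col j i
    colIrrefl : ∀ i → col i i ≡ none

open RBGraph public

underlying : ∀ {n} → RBGraph n → Graph n
underlying {n} Grb = record
  { adj = λ i j → isEdgeC (col Grb i j)
  ; sym = λ i j → symE i j
  ; irrefl = λ i → irr i }
  where
    open import Relation.Binary.PropositionalEquality using (cong)
    symE : ∀ i j → isEdgeC (col Grb i j) ≡ isEdgeC (col Grb j i)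
    symE i j = cong isEdgeC (colSym Grb i j)
    irr : ∀ i → isEdgeC (col Grb i i) ≡ false
    irr i = cong isEdgeC (colIrrefl Grb i)

count : ∀ {A : Set} → (A → Bool) → List A → ℕ
count p [] = 0
count p (x ∷ xs) = if p x then suc (count p xs) else count p xs

allPairs : ∀ n → List (Fin n × Fin n)
allPairs n = cartesianProduct (allFin n) (allFin n)

allSubsets : ∀ n → List (Subset n)
allSubsets zero = [] ∷ []
allSubsets (suc n) = map (true ∷_) (allSubsets n) ++ map (false ∷_) (allSubsets n)

memb : ∀ {n} → Fin n → Subset n → Bool
memb i S = lookup S i

eBlue : ∀ {n} → RBGraph n → ℕ
eBlue {n} Grb = count (λ p → (proj₁ p <ᵇ proj₂ p) ∧ isBlue (col Grb (proj₁ p) (proj₂ p))) (allPairs n)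

allB : ∀ {A : Set} → (A → Bool) → List A → Bool
allB p [] = true
allB p (x ∷ xs) = p x ∧ allB p xs

redClique : ∀ {n} → RBGraph n → Subset n → Bool
redClique {n} Grb S =
  allB (λ p → not ((proj₁ p <ᵇ proj₂ p) ∧ memb (proj₁ p) S ∧ memb (proj₂ p) S)
               ∨ isRed (col Grb (proj₁ p) (proj₂ p)))
        (allPairs n)

NKrRed : ∀ {n} → ℕ → RBGraph n → ℕ
NKrRed {n} r Grb = count (λ S → (∣ S ∣ ≡ᵇ r) ∧ redClique Grb S) (allSubsets n)

g : ∀ {n} → ℕ → RBGraph n → ℕ
g r Grb = eBlue Grb + NKrRed r Grb
  where open import Data.Nat using (_+_)

EdgeG : ∀ {n} → RBGraph n → Set
EdgeG Grb = Edge (underlying Grb)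

-- a matching in the auxiliary bipartite graph covering E(G):
-- an injective map M : E(G) → E(H) with e ⊆ M(e)
CoveringMatching : ∀ {r n} → RBGraph n → RGraph r n → Set
CoveringMatching Grb H =
  Σ (EdgeG Grb → Fin (eH H)) λ M →
    (∀ e₁ e₂ → M e₁ ≡ M e₂ → proj₁ e₁ ≡ proj₁ e₂) ×
    (∀ e → (proj₁ (proj₁ e) ∈ hedge H (M e)) × (proj₂ (proj₁ e) ∈ hedge H (M e)))

ContainsBlueOrRedKr : ∀ {n} → ℕ → RBGraph n → Subset n → Set
ContainsBlueOrRedKr {n} r Grb h =
  (Σ (Fin n × Fin n) λ p → (proj₁ p < proj₂ p) × (col Grb (proj₁ p) (proj₂ p) ≡ blue)
       × (proj₁ p ∈ h) × (proj₂ p ∈ h))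
  ⊎ (Σ (Subset n) λ S → (S ⊆ h) × (∣ S ∣ ≡ r) × (redClique Grb S ≡ true))

-- In the auxiliary bipartite graph between hyperedges and pairs, repeated searches for
-- augmenting paths give a matching μ and a set R of hyperedges such that every hyperedge outside
-- R is matched, and every pair inside a hyperedge of R is matched to a hyperedge of R (R is the
-- set of hyperedges reachable from unmatched ones by alternating paths). Let G be the set of
-- matched pairs, a pair being red if it lies in a hyperedge of R and blue otherwise. As μ is
-- injective, a copy of F in G yields a Berge-F in H, and G itself is covered by μ. A hyperedge
-- of R spans a red K_r. A hyperedge outside R is matched to a pair inside it, which is blue:
-- otherwise that pair would also be matched to a hyperedge of R. Both assignments are
-- injective, so e(H) ≤ e(G_blue) + N(K_r, G_red).
module Submission where

open import Defs hiding (sym)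
open import Data.Bool using (Bool; true; false; not; _∧_; _∨_)
open import Data.Bool.Properties using (T-≡)
open import Data.Fin using (Fin; _<_; toℕ)
open import Data.Fin.Properties using (_<?_; any?; <-asym; <-irrefl; <-cmp) renaming (_≟_ to _≟ᶠ_)
open import Data.Fin.Subset using (Subset; _∈_; _∉_; _⊆_; _⊃_; _∪_; ⁅_⁆; ∣_∣) renaming (⊥ to ∅)
open import Data.Fin.Subset.Properties using (_∈?_; x∈⁅x⁆; x∈⁅y⁆⇒x≡y; x∈p∪q⁻; p⊆p∪q; q⊆p∪q; ∉⊥; ⊆-refl; ∪-assoc)
open import Data.Fin.Subset.Induction using (⊃-wellFounded)
open import Data.List using (List; []; _∷_; length; allFin)
import Data.List as List
open import Data.List.Properties using (length-tabulate)
open import Data.List.Membership.Propositional using (_─_) renaming (_∈_ to _∈ₗ_)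
open import Data.List.Membership.Propositional.Properties using (∈-allFin; ∈-cartesianProduct⁺; ∈-map⁺; ∈-++⁺ˡ; ∈-++⁺ʳ; ∈-lookup)
open import Data.List.Relation.Unary.Any using (here; there)
open import Data.List.Relation.Unary.All using (All; []; _∷_)
import Data.List.Relation.Unary.All as All
open import Data.List.Relation.Unary.AllPairs using (_∷_)
open import Data.List.Relation.Unary.Unique.Propositional using (Unique)
open import Data.List.Relation.Unary.Unique.Propositional.Properties using (allFin⁺)
open import Data.Maybe using (Maybe; just; nothing)
open import Data.Maybe.Properties using (just-injective) renaming (≡-dec to ≡-decᴹ)
open import Data.Nat using (ℕ; suc; _≤_; _+_; z≤n; s≤s)
import Data.Nat as ℕ
open import Data.Nat.Properties using (+-suc; +-mono-≤; module ≤-Reasoning)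
import Data.Nat.Properties as ℕ
open import Data.Product using (Σ; ∃; _×_; _,_; proj₁; proj₂; map₂; swap)
open import Data.Product.Properties using () renaming (≡-dec to ≡-decˣ)
open import Data.Sum using (_⊎_; inj₁; inj₂)
import Data.Sum as Sum
open import Data.Vec using ([]; _∷_)
open import Data.Vec.Functional using (updateAt)
open import Data.Vec.Functional.Properties using (updateAt-updates; updateAt-minimal)
open import Data.Vec.Properties using ([]=⇒lookup; lookup⇒[]=)
open import Function using (_∘_; id; Equivalence)
open import Induction.WellFounded using (Acc; acc)
open import Relation.Binary.Definitions using (DecidableEquality; Tri; tri<; tri≈; tri>)
open import Relation.Binary.PropositionalEquality using (_≡_; _≢_; refl; sym; trans; cong; cong₂; subst)
open import Relation.Nullary using (Dec; yes; no; contradiction)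
open import Relation.Nullary.Decidable using (_×-dec_)

module _ {A : Set} where

  ∈-─ : ∀ {x y : A} {xs} (x∈xs : x ∈ₗ xs) → y ∈ₗ xs → y ≢ x → y ∈ₗ xs ─ x∈xs
  ∈-─ (here refl) (here refl) y≢x = contradiction refl y≢x
  ∈-─ (here refl) (there y∈xs) _  = y∈xs
  ∈-─ (there _)   (here refl)  _  = here refl
  ∈-─ (there x∈xs) (there y∈xs) y≢x = there (∈-─ x∈xs y∈xs y≢x)

  count-─ : ∀ (p : A → Bool) {x xs} (x∈xs : x ∈ₗ xs) → p x ≡ true →
            count p xs ≡ suc (count p (xs ─ x∈xs))
  count-─ p (here refl) px rewrite px = refl
  count-─ p {xs = y ∷ _} (there x∈xs) px with p y
  ... | true  = cong suc (count-─ p x∈xs px)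
  ... | false = count-─ p x∈xs px

  length≡count-not+count : ∀ (p : A → Bool) xs → length xs ≡ count (not ∘ p) xs + count p xs
  length≡count-not+count p [] = refl
  length≡count-not+count p (x ∷ xs) with p x
  ... | true  = trans (cong suc (length≡count-not+count p xs)) (sym (+-suc _ _))
  ... | false = cong suc (length≡count-not+count p xs)

  allB-true : ∀ {p : A → Bool} → (∀ x → p x ≡ true) → ∀ xs → allB p xs ≡ true
  allB-true p-true []       = refl
  allB-true p-true (x ∷ xs) rewrite p-true x = allB-true p-true xs

  lookup-injective : ∀ {xs : List A} → Unique xs →
                     ∀ i j → List.lookup xs i ≡ List.lookup xs j → i ≡ j
  lookup-injective (_ ∷ _) Fin.zero Fin.zero _ = refl
  lookup-injective (x∉xs ∷ _) Fin.zero (Fin.suc j) eq = contradiction eq (All.lookup x∉xs (∈-lookup j))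
  lookup-injective (x∉xs ∷ _) (Fin.suc i) Fin.zero eq = contradiction (sym eq) (All.lookup x∉xs (∈-lookup i))
  lookup-injective (_ ∷ unique) (Fin.suc i) (Fin.suc j) eq = cong Fin.suc (lookup-injective unique i j eq)

module _ {A B : Set} (p : A → Bool) (q : B → Bool) (_∼_ : A → B → Set)
         (∼-injective : ∀ {a a′ b} → a ∼ b → a′ ∼ b → a ≡ a′) where

  count-≤-injection : ∀ {xs ys} → Unique xs →
            (∀ {a} → a ∈ₗ xs → p a ≡ true → ∃ λ b → b ∈ₗ ys × q b ≡ true × a ∼ b) →
            count p xs ≤ count q ys
  count-≤-injection {[]} _ _ = z≤n
  count-≤-injection {a ∷ xs} (_ ∷ unique) partner with p a in pa
  ... | false = count-≤-injection unique (partner ∘ there)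
  count-≤-injection {a ∷ xs} {ys} (a∉xs ∷ unique) partner | true with partner (here refl) pa
  ... | b , b∈ys , qb , a∼b = begin
    suc (count p xs)            ≤⟨ s≤s (count-≤-injection unique partner′) ⟩
    suc (count q (ys ─ b∈ys))   ≡⟨ count-─ q b∈ys qb ⟨
    count q ys                  ∎
    where
    open ≤-Reasoning
    partner′ : ∀ {a′} → a′ ∈ₗ xs → p a′ ≡ true →
               ∃ λ b′ → b′ ∈ₗ ys ─ b∈ys × q b′ ≡ true × a′ ∼ b′
    partner′ a′∈xs pa′ with partner (there a′∈xs) pa′
    ... | b′ , b′∈ys , qb′ , a′∼b′ = b′ , ∈-─ b∈ys b′∈ys b′≢b , qb′ , a′∼b′
      where
      b′≢b : b′ ≢ b
      b′≢b refl = All.lookup a∉xs a′∈xs (∼-injective a∼b a′∼b′)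

∪-monoˡ-⊆ : ∀ {n} {p q : Subset n} r → p ⊆ q → p ∪ r ⊆ q ∪ r
∪-monoˡ-⊆ {p = p} r p⊆q x∈p∪r with x∈p∪q⁻ p r x∈p∪r
... | inj₁ x∈p = p⊆p∪q r (p⊆q x∈p)
... | inj₂ x∈r = q⊆p∪q _ r x∈r

module BipartiteMatching
  {m : ℕ} {Y : Set} (_≟_ : DecidableEquality Y)
  (_~_ : Fin m → Y → Set) (_~?_ : ∀ x y → Dec (x ~ y))
  (Ys : List Y) (∈-Ys : ∀ y → y ∈ₗ Ys)
  where

  Matching : Set
  Matching = Fin m → Maybe Y

  record IsMatching (μ : Matching) : Set where
    field
      along     : ∀ {x y} → μ x ≡ just y → x ~ y
      injective : ∀ {x x′ y} → μ x ≡ just y → μ x′ ≡ just y → x ≡ x′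

  Matched : Matching → Fin m → Set
  Matched μ x = ∃ λ y → μ x ≡ just y

  InImage : Matching → Y → Set
  InImage μ y = ∃ λ w → μ w ≡ just y

  inImage? : ∀ μ y → Dec (InImage μ y)
  inImage? μ y = any? λ w → ≡-decᴹ _≟_ (μ w) (just y)

  _⟨_⟩∋_ : Matching → Subset m → Y → Set
  μ ⟨ T ⟩∋ y = ∃ λ w → w ∈ T × μ w ≡ just y

  ⟨⟩∋-mono : ∀ {μ T T′ y} → T ⊆ T′ → μ ⟨ T ⟩∋ y → μ ⟨ T′ ⟩∋ y
  ⟨⟩∋-mono T⊆T′ (w , w∈T , μw) = w , T⊆T′ w∈T , μw

  N[_]⊆_⟨_⟩ : Subset m → Matching → Subset m → Set
  N[ D ]⊆ μ ⟨ T ⟩ = ∀ {z y} → z ∈ D → z ~ y → μ ⟨ T ⟩∋ y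

  N⊆-mono : ∀ {D T T′ μ} → T ⊆ T′ → N[ D ]⊆ μ ⟨ T ⟩ → N[ D ]⊆ μ ⟨ T′ ⟩
  N⊆-mono T⊆T′ N⊆ z∈D z~y = ⟨⟩∋-mono T⊆T′ (N⊆ z∈D z~y)

  N⊆-∪ : ∀ {D₁ D₂ T μ} → N[ D₁ ]⊆ μ ⟨ T ⟩ → N[ D₂ ]⊆ μ ⟨ T ⟩ →
         N[ D₁ ∪ D₂ ]⊆ μ ⟨ T ⟩
  N⊆-∪ {D₁} {D₂} N⊆₁ N⊆₂ z∈D₁∪D₂ with x∈p∪q⁻ D₁ D₂ z∈D₁∪D₂
  ... | inj₁ z∈D₁ = N⊆₁ z∈D₁
  ... | inj₂ z∈D₂ = N⊆₂ z∈D₂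

  -- The two outcomes of a search for an augmenting path from x that avoids the visited set S.
  record Augmented (μ : Matching) (S : Subset m) (x : Fin m) : Set where
    field
      μ′         : Matching
      isMatching : IsMatching μ′
      fixes      : ∀ {z} → z ∈ S → μ′ z ≡ μ z
      keeps      : ∀ {z} → Matched μ z → Matched μ′ z
      matches    : Matched μ′ x
      frees      : ∀ {y v} → μ x ≡ just y → μ′ v ≢ just y

  record Stuck (μ : Matching) (S : Subset m) (x : Fin m) : Set where
    field
      D      : Subset m
      x∈D    : x ∈ D
      closed : N[ D ]⊆ μ ⟨ D ∪ S ⟩

  module _ {μ : Matching} (isMatching : IsMatching μ) where
    open IsMatching

    reassign : ∀ {S x y μ′} → x ∉ S → IsMatching μ′ →
               (∀ {z} → z ∈ ⁅ x ⁆ ∪ S → μ′ z ≡ μ z) →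
               (∀ {z} → Matched μ z → Matched μ′ z) →
               x ~ y → (∀ {v} → μ′ v ≢ just y) → Augmented μ S x
    reassign {S} {x} {y} {μ′} x∉S μ′-matching fixes keeps x~y y-free = record
      { μ′ = μ″ ; isMatching = μ″-matching ; fixes = fixes″ ; keeps = keeps″
      ; matches = y , μ″x ; frees = frees″ }
      where
      μ″ : Matching
      μ″ = updateAt μ′ x λ _ → just y

      μ″x : μ″ x ≡ just y
      μ″x = updateAt-updates x μ′

      μ″x⇒y : ∀ {t} → μ″ x ≡ just t → y ≡ t
      μ″x⇒y μ″x≡t = just-injective (trans (sym μ″x) μ″x≡t)

      μ″-elsewhere : ∀ {z} → z ≢ x → μ″ z ≡ μ′ z
      μ″-elsewhere z≢x = updateAt-minimal _ x μ′ z≢x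

      μ″⇒μ′ : ∀ {z t} → z ≢ x → μ″ z ≡ just t → μ′ z ≡ just t
      μ″⇒μ′ z≢x = trans (sym (μ″-elsewhere z≢x))

      μ′x : μ′ x ≡ μ x
      μ′x = fixes (p⊆p∪q S (x∈⁅x⁆ x))

      μ″-matching : IsMatching μ″
      μ″-matching .along {z} μ″z with z ≟ᶠ x
      ... | yes refl with refl ← μ″x⇒y μ″z = x~y
      ... | no z≢x = along μ′-matching (μ″⇒μ′ z≢x μ″z)
      μ″-matching .injective {z} {z′} μ″z μ″z′ with z ≟ᶠ x | z′ ≟ᶠ x
      ... | yes refl | yes refl = refl
      ... | yes refl | no z′≢x with refl ← μ″x⇒y μ″z = contradiction (μ″⇒μ′ z′≢x μ″z′) y-free
      ... | no z≢x | yes refl with refl ← μ″x⇒y μ″z′ = contradiction (μ″⇒μ′ z≢x μ″z) y-free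
      ... | no z≢x | no z′≢x = injective μ′-matching (μ″⇒μ′ z≢x μ″z) (μ″⇒μ′ z′≢x μ″z′)

      fixes″ : ∀ {z} → z ∈ S → μ″ z ≡ μ z
      fixes″ z∈S = trans (μ″-elsewhere λ { refl → x∉S z∈S }) (fixes (q⊆p∪q _ S z∈S))

      keeps″ : ∀ {z} → Matched μ z → Matched μ″ z
      keeps″ {z} z-matched with z ≟ᶠ x | keeps z-matched
      ... | yes refl | _        = y , μ″x
      ... | no z≢x   | y′ , μ′z = y′ , trans (μ″-elsewhere z≢x) μ′z

      frees″ : ∀ {y₀ v} → μ x ≡ just y₀ → μ″ v ≢ just y₀
      frees″ {v = v} μx μ″v with v ≟ᶠ x
      ... | yes refl with refl ← μ″x⇒y μ″v = y-free (trans μ′x μx)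
      ... | no v≢x = v≢x (injective μ′-matching (μ″⇒μ′ v≢x μ″v) (trans μ′x μx))

    search : ∀ S → Acc _⊃_ S → ∀ x → x ∉ S → Augmented μ S x ⊎ Stuck μ S x
    search S (acc larger) x x∉S = Sum.map₂ conclude (explore Ys)
      where
      S′ : Subset m
      S′ = ⁅ x ⁆ ∪ S

      x∈S′ : x ∈ S′
      x∈S′ = p⊆p∪q S (x∈⁅x⁆ x)

      S′⊃S : S′ ⊃ S
      S′⊃S = q⊆p∪q _ S , x , x∈S′ , x∉S

      Explored : List Y → Set
      Explored ys = Σ (Subset m) λ D →
        N[ D ]⊆ μ ⟨ D ∪ S′ ⟩ × All (λ y → x ~ y → μ ⟨ D ∪ S′ ⟩∋ y) ys

      cons : ∀ {y ys} → (∀ D → x ~ y → μ ⟨ D ∪ S′ ⟩∋ y) → Explored ys → Explored (y ∷ ys)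
      cons y-handled (D , closed , handled) = D , closed , y-handled D ∷ handled

      -- A free neighbour y of x, or a successful search from the partner of y outside S′,
      -- gives an augmenting path; otherwise y is matched into D ∪ S′, where D collects the
      -- sets returned by the failed searches.
      explore : ∀ ys → Augmented μ S x ⊎ Explored ys
      explore [] = inj₂ (∅ , (λ z∈∅ → contradiction z∈∅ ∉⊥) , [])
      explore (y ∷ ys) with x ~? y | inImage? μ y
      ... | no x≁y | _ = Sum.map₂ (cons λ _ x~y → contradiction x~y x≁y) (explore ys)
      ... | yes x~y | no y-free = inj₁ (reassign x∉S isMatching (λ _ → refl) id x~y (y-free ∘ (_ ,_)))
      ... | yes x~y | yes (w , μw) with w ∈? S′
      ...   | yes w∈S′ = Sum.map₂ (cons λ D _ → w , q⊆p∪q D S′ w∈S′ , μw) (explore ys)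
      ...   | no w∉S′ with search S′ (larger S′⊃S) w w∉S′
      ...     | inj₁ aug = inj₁ (reassign x∉S A.isMatching A.fixes A.keeps x~y (A.frees μw))
        where module A = Augmented aug
      ...     | inj₂ stuck = Sum.map₂ merge (explore ys)
        where
        open Stuck stuck renaming (D to Dw; x∈D to w∈Dw; closed to Dw-closed)
        merge : Explored ys → Explored (y ∷ ys)
        merge (D , closed , handled) =
          Dw ∪ D , N⊆-∪ (N⊆-mono Dw⊆ Dw-closed) (N⊆-mono D⊆ closed) ,
          (λ _ → w , Dw⊆ (p⊆p∪q S′ w∈Dw) , μw) ∷ All.map (⟨⟩∋-mono D⊆ ∘_) handled
          where
          Dw⊆ : Dw ∪ S′ ⊆ (Dw ∪ D) ∪ S′
          Dw⊆ = ∪-monoˡ-⊆ S′ (p⊆p∪q D)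
          D⊆ : D ∪ S′ ⊆ (Dw ∪ D) ∪ S′
          D⊆ = ∪-monoˡ-⊆ S′ (q⊆p∪q Dw D)

      conclude : Explored Ys → Stuck μ S x
      conclude (D , closed , handled) = record
        { D = D ∪ ⁅ x ⁆ ; x∈D = q⊆p∪q D _ (x∈⁅x⁆ x)
        ; closed = subst (λ T → N[ D ∪ ⁅ x ⁆ ]⊆ μ ⟨ T ⟩) (sym (∪-assoc D ⁅ x ⁆ S))
                         (N⊆-∪ closed x-closed) }
        where
        x-closed : N[ ⁅ x ⁆ ]⊆ μ ⟨ D ∪ S′ ⟩
        x-closed z∈⁅x⁆ z~y with refl ← x∈⁅y⁆⇒x≡y x z∈⁅x⁆ = All.lookup handled (∈-Ys _) z~y

  record Decomposition (xs : List (Fin m)) : Set where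
    field
      μ          : Matching
      isMatching : IsMatching μ
      R          : Subset m
      closed     : N[ R ]⊆ μ ⟨ R ⟩
      matched    : ∀ {x} → x ∈ₗ xs → x ∉ R → Matched μ x

  private
    emptyDecomposition : Decomposition []
    emptyDecomposition = record
      { μ = λ _ → nothing ; isMatching = record { along = λ () ; injective = λ () }
      ; R = ∅ ; closed = λ z∈∅ → contradiction z∈∅ ∉⊥ ; matched = λ () }

    extend : ∀ x {xs} → Decomposition xs → Decomposition (x ∷ xs)
    extend x d with x ∈? Decomposition.R d
    ... | yes x∈R = record
      { μ = μ ; isMatching = isMatching ; R = R ; closed = closed
      ; matched = λ { (here refl) x∉R → contradiction x∈R x∉R ; (there x′∈xs) → matched x′∈xs } }
      where open Decomposition d
    ... | no x∉R with search isMatching R (⊃-wellFounded R) x x∉R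
      where open Decomposition d
    ...   | inj₁ aug = record
      { μ = μ′ ; isMatching = A.isMatching ; R = R ; closed = closed′
      ; matched = λ { (here refl) _ → matches ; (there x′∈xs) x′∉R → keeps (matched x′∈xs x′∉R) } }
      where
      open Decomposition d
      open Augmented aug using (μ′; fixes; keeps; matches)
      module A = Augmented aug
      closed′ : N[ R ]⊆ μ′ ⟨ R ⟩
      closed′ z∈R z~y with closed z∈R z~y
      ... | w , w∈R , μw = w , w∈R , trans (fixes w∈R) μw
    ...   | inj₂ stuck = record
      { μ = μ ; isMatching = isMatching ; R = D ∪ R
      ; closed = N⊆-∪ S.closed (N⊆-mono (q⊆p∪q D R) closed)
      ; matched = λ { (here refl) x∉D∪R → contradiction (p⊆p∪q R x∈D) x∉D∪R
                    ; (there x′∈xs) x′∉D∪R → matched x′∈xs (x′∉D∪R ∘ q⊆p∪q D R) } }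
      where
      open Decomposition d
      open Stuck stuck using (D; x∈D)
      module S = Stuck stuck

  decompose : ∀ xs → Decomposition xs
  decompose []       = emptyDecomposition
  decompose (x ∷ xs) = extend x (decompose xs)

Pair : ℕ → Set
Pair n = Fin n × Fin n

_⊏_ : ∀ {n} → Pair n → Subset n → Set
(i , j) ⊏ h = i < j × i ∈ h × j ∈ h

_⊏?_ : ∀ {n} (p : Pair n) h → Dec (p ⊏ h)
(i , j) ⊏? h = (i <? j) ×-dec (i ∈? h) ×-dec (j ∈? h)

sorted-pair-≡ : ∀ {n} {i j i′ j′ : Fin n} → i < j → i′ < j′ →
                (i ≡ i′ × j ≡ j′) ⊎ (i ≡ j′ × j ≡ i′) → (i , j) ≡ (i′ , j′)
sorted-pair-≡ _   _     (inj₁ (refl , refl)) = refl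
sorted-pair-≡ i<j i′<j′ (inj₂ (refl , refl)) = contradiction i<j (<-asym i′<j′)

<ᵇ≡true⇒< : ∀ {n} {i j : Fin n} → (i <ᵇ j) ≡ true → i < j
<ᵇ≡true⇒< {i = i} {j} i<ᵇj = ℕ.<ᵇ⇒< (toℕ i) (toℕ j) (Equivalence.from T-≡ i<ᵇj)

<⇒<ᵇ≡true : ∀ {n} {i j : Fin n} → i < j → (i <ᵇ j) ≡ true
<⇒<ᵇ≡true i<j = Equivalence.to T-≡ (ℕ.<⇒<ᵇ i<j)

memb≡true⇒∈ : ∀ {n} {i : Fin n} {S} → memb i S ≡ true → i ∈ S
memb≡true⇒∈ {i = i} {S} = lookup⇒[]= i S

not-memb≡true⇒∉ : ∀ {n} {i : Fin n} {S} → not (memb i S) ≡ true → i ∉ S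
not-memb≡true⇒∉ not-i∈S i∈S with () ← subst (λ b → not b ≡ true) ([]=⇒lookup i∈S) not-i∈S

∈-allPairs : ∀ {n} (p : Pair n) → p ∈ₗ allPairs n
∈-allPairs (i , j) = ∈-cartesianProduct⁺ (∈-allFin i) (∈-allFin j)

∈-allSubsets : ∀ {n} (S : Subset n) → S ∈ₗ allSubsets n
∈-allSubsets []          = here refl
∈-allSubsets (true ∷ S)  = ∈-++⁺ˡ (∈-map⁺ (true ∷_) (∈-allSubsets S))
∈-allSubsets (false ∷ S) = ∈-++⁺ʳ _ (∈-map⁺ (false ∷_) (∈-allSubsets S))

module RedBlueConstruction {r n} (H : RGraph r n) where

  _~_ : Fin (eH H) → Pair n → Set
  w ~ p = p ⊏ hedge H w

  _~?_ : ∀ w p → Dec (w ~ p)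
  w ~? p = p ⊏? hedge H w

  open BipartiteMatching (≡-decˣ _≟ᶠ_ _≟ᶠ_) _~_ _~?_ (allPairs n) ∈-allPairs
  open Decomposition (decompose (allFin (eH H)))
  open IsMatching isMatching

  hedge-size : ∀ w → ∣ hedge H w ∣ ≡ r
  hedge-size w = All.lookup (uniform H) (∈-lookup w)

  inRedHyperedge? : ∀ p → Dec (∃ λ w → w ∈ R × w ~ p)
  inRedHyperedge? p = any? λ w → (w ∈? R) ×-dec (w ~? p)

  pairColour : Pair n → Colour
  pairColour p with inImage? μ p | inRedHyperedge? p
  ... | no _  | _     = none
  ... | yes _ | yes _ = red
  ... | yes _ | no _  = blue

  pairColour-owned : ∀ p → isEdgeC (pairColour p) ≡ true → InImage μ p
  pairColour-owned p _ with inImage? μ p | inRedHyperedge? p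
  pairColour-owned p () | no _  | _
  ... | yes owned | _ = owned

  pairColour-red : ∀ {w p} → w ∈ R → w ~ p → pairColour p ≡ red
  pairColour-red {w} {p} w∈R w~p with inImage? μ p | inRedHyperedge? p
  ... | yes _ | yes _     = refl
  ... | yes _ | no not-red = contradiction (w , w∈R , w~p) not-red
  ... | no not-owned | _  with v , _ , μv ← closed w∈R w~p = contradiction (v , μv) not-owned

  pairColour-blue : ∀ {w p} → w ∉ R → μ w ≡ just p → pairColour p ≡ blue
  pairColour-blue {w} {p} w∉R μw with inImage? μ p | inRedHyperedge? p
  ... | yes _ | no _ = refl
  ... | no not-owned | _ = contradiction (w , μw) not-owned
  ... | yes _ | yes (v , v∈R , v~p) with u , u∈R , μu ← closed v∈R v~p
    with refl ← injective μu μw = contradiction u∈R w∉R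

  colour : Fin n → Fin n → Colour
  colour i j with <-cmp i j
  ... | tri< _ _ _ = pairColour (i , j)
  ... | tri≈ _ _ _ = none
  ... | tri> _ _ _ = pairColour (j , i)

  colour-< : ∀ {i j} → i < j → colour i j ≡ pairColour (i , j)
  colour-< {i} {j} i<j with <-cmp i j
  ... | tri< _ _ _    = refl
  ... | tri≈ i≮j _ _  = contradiction i<j i≮j
  ... | tri> i≮j _ _  = contradiction i<j i≮j

  colour-> : ∀ {i j} → j < i → colour i j ≡ pairColour (j , i)
  colour-> {i} {j} j<i with <-cmp i j
  ... | tri< _ _ j≮i  = contradiction j<i j≮i
  ... | tri≈ _ _ j≮i  = contradiction j<i j≮i
  ... | tri> _ _ _    = refl

  colour-sym : ∀ i j → colour i j ≡ colour j i
  colour-sym i j = by-trichotomy (<-cmp i j)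
    where
    by-trichotomy : Tri (i < j) (i ≡ j) (j < i) → colour i j ≡ colour j i
    by-trichotomy (tri< i<j _ _) = trans (colour-< i<j) (sym (colour-> i<j))
    by-trichotomy (tri≈ _ refl _) = refl
    by-trichotomy (tri> _ _ j<i) = trans (colour-> j<i) (sym (colour-< j<i))

  colour-irrefl : ∀ i → colour i i ≡ none
  colour-irrefl i with <-cmp i i
  ... | tri< i<i _ _ = contradiction i<i (<-irrefl refl)
  ... | tri≈ _ _ _   = refl
  ... | tri> _ _ i<i = contradiction i<i (<-irrefl refl)

  Grb : RBGraph n
  Grb = record { col = colour ; colSym = colour-sym ; colIrrefl = colour-irrefl }

  red-edge : ∀ {w i j} → w ∈ R → w ~ (i , j) → colour i j ≡ red
  red-edge w∈R w~ij@(i<j , _) = trans (colour-< i<j) (pairColour-red w∈R w~ij)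

  blue-edge : ∀ {w i j} → w ∉ R → μ w ≡ just (i , j) → colour i j ≡ blue
  blue-edge w∉R μw = trans (colour-< (proj₁ (along μw))) (pairColour-blue w∉R μw)

  μ-functional : ∀ {w p p′} → μ w ≡ just p → μ w ≡ just p′ → p ≡ p′
  μ-functional μw μw′ = just-injective (trans (sym μw) μw′)

  Owns : Fin (eH H) → Fin n → Fin n → Set
  Owns w i j = μ w ≡ just (i , j) ⊎ μ w ≡ just (j , i)

  edge-owner : ∀ i j → isEdgeC (colour i j) ≡ true → ∃ λ w → Owns w i j
  edge-owner i j ij∈G with <-cmp i j
  ... | tri< _ _ _ = map₂ inj₁ (pairColour-owned (i , j) ij∈G)
  ... | tri> _ _ _ = map₂ inj₂ (pairColour-owned (j , i) ij∈G)

  owns-⊆ : ∀ {w i j} → Owns w i j → i ∈ hedge H w × j ∈ hedge H w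
  owns-⊆ (inj₁ μw) = proj₂ (along μw)
  owns-⊆ (inj₂ μw) = swap (proj₂ (along μw))

  owns-functional : ∀ {w i j i′ j′} → Owns w i j → Owns w i′ j′ →
                    (i ≡ i′ × j ≡ j′) ⊎ (i ≡ j′ × j ≡ i′)
  owns-functional (inj₁ μw) (inj₁ μw′) with refl ← μ-functional μw μw′ = inj₁ (refl , refl)
  owns-functional (inj₁ μw) (inj₂ μw′) with refl ← μ-functional μw μw′ = inj₂ (refl , refl)
  owns-functional (inj₂ μw) (inj₁ μw′) with refl ← μ-functional μw μw′ = inj₂ (refl , refl)
  owns-functional (inj₂ μw) (inj₂ μw′) with refl ← μ-functional μw μw′ = inj₁ (refl , refl)

  subgraphCopy⇒bergeCopy : ∀ {k} {F : Graph k} → SubgraphCopy F (underlying Grb) → BergeCopy F H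
  subgraphCopy⇒bergeCopy {F = F} (f , f-injective , f-adj) = f , f-injective , φ , φ-injective , φ-⊇
    where
    owner : (e : Edge F) → ∃ λ w → Owns w (f (proj₁ (proj₁ e))) (f (proj₂ (proj₁ e)))
    owner ((u , v) , _ , uv∈F) = edge-owner (f u) (f v) (f-adj u v uv∈F)

    φ : Edge F → Fin (eH H)
    φ = proj₁ ∘ owner

    φ-⊇ : ∀ e → f (proj₁ (proj₁ e)) ∈ hedge H (φ e) × f (proj₂ (proj₁ e)) ∈ hedge H (φ e)
    φ-⊇ e = owns-⊆ (proj₂ (owner e))

    φ-injective : ∀ e₁ e₂ → φ e₁ ≡ φ e₂ → proj₁ e₁ ≡ proj₁ e₂
    φ-injective e₁@(_ , u₁<v₁ , _) e₂@(_ , u₂<v₂ , _) φe₁≡φe₂ =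
      sorted-pair-≡ u₁<v₁ u₂<v₂ (Sum.map pull-back pull-back
        (owns-functional (subst (λ w → Owns w _ _) φe₁≡φe₂ (proj₂ (owner e₁))) (proj₂ (owner e₂))))
      where
      pull-back : ∀ {a b c d} → f a ≡ f b × f c ≡ f d → a ≡ b × c ≡ d
      pull-back (fa≡fb , fc≡fd) = f-injective _ _ fa≡fb , f-injective _ _ fc≡fd

  coveringMatching : CoveringMatching Grb H
  coveringMatching =
    proj₂ (proj₂ (subgraphCopy⇒bergeCopy {F = underlying Grb} (id , (λ _ _ → id) , (λ _ _ → id))))

  redClique-hedge : ∀ {w} → w ∈ R → redClique Grb (hedge H w) ≡ true
  redClique-hedge {w} w∈R = allB-true (λ (i , j) → red-inside i j) (allPairs n)
    where
    red-inside : ∀ i j →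
      not ((i <ᵇ j) ∧ memb i (hedge H w) ∧ memb j (hedge H w)) ∨ isRed (colour i j) ≡ true
    red-inside i j with i <ᵇ j in i<j | memb i (hedge H w) in i∈w | memb j (hedge H w) in j∈w
    ... | true  | true  | true  =
      cong isRed (red-edge w∈R (<ᵇ≡true⇒< i<j , memb≡true⇒∈ i∈w , memb≡true⇒∈ j∈w))
    ... | false | _     | _     = refl
    ... | true  | false | _     = refl
    ... | true  | true  | false = refl

  containsBlueOrRedKr : ∀ w → ContainsBlueOrRedKr r Grb (hedge H w)
  containsBlueOrRedKr w with w ∈? R
  ... | yes w∈R = inj₂ (hedge H w , ⊆-refl , hedge-size w , redClique-hedge w∈R)
  ... | no w∉R with (i , j) , μw ← matched (∈-allFin w) w∉R
    with i<j , i∈w , j∈w ← along μw = inj₁ ((i , j) , i<j , blue-edge w∉R μw , i∈w , j∈w)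

  inR : Fin (eH H) → Bool
  inR w = memb w R

  hyperedges : List (Fin (eH H))
  hyperedges = allFin (eH H)

  outside-R≤eBlue : count (not ∘ inR) hyperedges ≤ eBlue Grb
  outside-R≤eBlue = count-≤-injection _ _ (λ w p → μ w ≡ just p) injective (allFin⁺ _) blue-partner
    where
    blue-partner : ∀ {w} → w ∈ₗ hyperedges → not (inR w) ≡ true →
                   ∃ λ p → p ∈ₗ allPairs n ×
                     ((proj₁ p <ᵇ proj₂ p) ∧ isBlue (colour (proj₁ p) (proj₂ p))) ≡ true × μ w ≡ just p
    blue-partner w∈ w-outside-R with w∉R ← not-memb≡true⇒∉ w-outside-R
      with p , μw ← matched w∈ w∉R =
      p , ∈-allPairs p ,
      cong₂ _∧_ (<⇒<ᵇ≡true (proj₁ (along μw))) (cong isBlue (blue-edge w∉R μw)) , μw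

  inside-R≤NKrRed : count inR hyperedges ≤ NKrRed r Grb
  inside-R≤NKrRed = count-≤-injection _ _ (λ w S → hedge H w ≡ S) hedge-injective (allFin⁺ _) red-partner
    where
    hedge-injective : ∀ {w w′ S} → hedge H w ≡ S → hedge H w′ ≡ S → w ≡ w′
    hedge-injective hw hw′ = lookup-injective (unique H) _ _ (trans hw (sym hw′))

    red-partner : ∀ {w} → w ∈ₗ hyperedges → inR w ≡ true →
                  ∃ λ S → S ∈ₗ allSubsets n × ((∣ S ∣ ℕ.≡ᵇ r) ∧ redClique Grb S) ≡ true × hedge H w ≡ S
    red-partner {w} _ w∈R =
      hedge H w , ∈-allSubsets _ ,
      cong₂ _∧_ (Equivalence.to T-≡ (ℕ.≡⇒≡ᵇ _ _ (hedge-size w))) (redClique-hedge (memb≡true⇒∈ w∈R)) ,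
      refl

  eH≤g : eH H ≤ g r Grb
  eH≤g = begin
    eH H                                                 ≡⟨ length-tabulate id ⟨
    length hyperedges                                    ≡⟨ length≡count-not+count inR hyperedges ⟩
    count (not ∘ inR) hyperedges + count inR hyperedges  ≤⟨ +-mono-≤ outside-R≤eBlue inside-R≤NKrRed ⟩
    g r Grb                                              ∎
    where open ≤-Reasoning

proposition2p2 : (𝓕 : Family) (r n : ℕ) (H : RGraph r n) → BergeFree 𝓕 H →
    Σ (RBGraph n) λ Grb →
      FFree 𝓕 (underlying Grb) ×
      CoveringMatching Grb H ×
      (eH H ≤ g r Grb) ×
      (∀ (i : Fin (eH H)) → ContainsBlueOrRedKr r Grb (hedge H i))
proposition2p2 𝓕 r n H berge-free =
  Grb , fFree , coveringMatching , eH≤g , containsBlueOrRedKr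
  where
  open RedBlueConstruction H

  fFree : FFree 𝓕 (underlying Grb)
  fFree k F F∈𝓕 = berge-free k F F∈𝓕 ∘ subgraphCopy⇒bergeCopy {F = F}
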